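{- If $L_0$ and $L_1$ are lattices with CLSP, then the direct product $L_0\times L_1$ has CLSP.
   Context: For a lattice $T$, $\mathcal{C}_L(T)$ is the set of nonempty convex sublattices of $T$ ordered by the bi-dominating order ($X\le Y$ iff every element of $X$ is below some element of $Y$ and every element of $Y$ is above some element of $X$). $T$ has CLSP if there is an order preserving map $\varphi:\mathcal{C}_L(T)\to T$ with $\varphi(S)\in S$ for all $S\in\mathcal{C}_L(T)$. The direct product has the componentwise order. -}

module Defs where

open import Level using (Level; suc; _⊔_)
open import Data.Product using (Σ; ∃; _×_; _,_; proj₁; proj₂)
open import Data.Product.Relation.Binary.Pointwise.NonDependent
  using (Pointwise; ×-isPartialOrder)
open import Relation.Unary using (Pred; _∈_)
open import Relation.Binary.Lattice.Bundles using (Lattice)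

record ConvexSublattice {c ℓ₁ ℓ₂ : Level} (T : Lattice c ℓ₁ ℓ₂) : Set (suc c ⊔ ℓ₂) where
  open Lattice T
  field
    member   : Pred Carrier c
    nonempty : ∃ λ x → x ∈ member
    convex   : ∀ {x y z} → x ∈ member → z ∈ member → x ≤ y → y ≤ z → y ∈ member
    ∧-closed : ∀ {x y} → x ∈ member → y ∈ member → (x ∧ y) ∈ member
    ∨-closed : ∀ {x y} → x ∈ member → y ∈ member → (x ∨ y) ∈ member

_≤bd_ : {c ℓ₁ ℓ₂ : Level} {T : Lattice c ℓ₁ ℓ₂} →
        ConvexSublattice T → ConvexSublattice T → Set (c ⊔ ℓ₂)
_≤bd_ {T = T} X Y =
  (∀ x → x ∈ ConvexSublattice.member X → ∃ λ y → y ∈ ConvexSublattice.member Y × x ≤ y)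
  × (∀ y → y ∈ ConvexSublattice.member Y → ∃ λ x → x ∈ ConvexSublattice.member X × x ≤ y)
  where open Lattice T

CLSP : {c ℓ₁ ℓ₂ : Level} → Lattice c ℓ₁ ℓ₂ → Set (suc c ⊔ ℓ₂)
CLSP T =
  Σ (ConvexSublattice T → Carrier) λ φ →
    (∀ S → φ S ∈ ConvexSublattice.member S)
    × (∀ X Y → X ≤bd Y → φ X ≤ φ Y)
  where open Lattice T

_×L_ : {c₀ ℓ₀ ℓ₀' c₁ ℓ₁ ℓ₁' : Level} →
       Lattice c₀ ℓ₀ ℓ₀' → Lattice c₁ ℓ₁ ℓ₁' →
       Lattice (c₀ ⊔ c₁) (ℓ₀ ⊔ ℓ₁) (ℓ₀' ⊔ ℓ₁')
L₀ ×L L₁ = record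
  { Carrier   = L₀.Carrier × L₁.Carrier
  ; _≈_       = Pointwise L₀._≈_ L₁._≈_
  ; _≤_       = Pointwise L₀._≤_ L₁._≤_
  ; _∨_       = λ p q → (proj₁ p L₀.∨ proj₁ q) , (proj₂ p L₁.∨ proj₂ q)
  ; _∧_       = λ p q → (proj₁ p L₀.∧ proj₁ q) , (proj₂ p L₁.∧ proj₂ q)
  ; isLattice = record
    { isPartialOrder = ×-isPartialOrder L₀.isPartialOrder L₁.isPartialOrder
    ; supremum = λ p q →
        let (a₀ , b₀ , c₀) = L₀.supremum (proj₁ p) (proj₁ q)
            (a₁ , b₁ , c₁) = L₁.supremum (proj₂ p) (proj₂ q)
        in (a₀ , a₁) , (b₀ , b₁) , λ z u v → c₀ (proj₁ z) (proj₁ u) (proj₁ v) , c₁ (proj₂ z) (proj₂ u) (proj₂ v)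
    ; infimum = λ p q →
        let (a₀ , b₀ , c₀) = L₀.infimum (proj₁ p) (proj₁ q)
            (a₁ , b₁ , c₁) = L₁.infimum (proj₂ p) (proj₂ q)
        in (a₀ , a₁) , (b₀ , b₁) , λ z u v → c₀ (proj₁ z) (proj₁ u) (proj₁ v) , c₁ (proj₂ z) (proj₂ u) (proj₂ v)
    }
  }
  where
  module L₀ = Lattice L₀
  module L₁ = Lattice L₁

-- A convex sublattice S of L₀ × L₁ has a convex sublattice π S of L₀ as its
-- first projection, and over each a ∈ π S a convex sublattice of L₁ as its
-- fibre. Choose a := φ₀ (π S) and then φ₁ of the fibre over a. Projection is
-- monotone for the bi-dominating order, and so is passing to fibres, over
-- any two base points whatsoever: a dominating point (p , q) of Y can be
-- pulled back into the fibre over a' by joining it with a point of that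
-- fibre and using convexity, and dually with meets.

module Submission where

open import Defs
open import Level using (Level)
open import Relation.Binary.Lattice.Bundles using (Lattice)
open import Relation.Unary using (_∈_)
open import Data.Product using (∃; _×_; _,_)

module _ {c ℓ₀ ℓ₀' ℓ₁ ℓ₁' : Level} (L₀ : Lattice c ℓ₀ ℓ₀') (L₁ : Lattice c ℓ₁ ℓ₁') where
  private
    module L₀ = Lattice L₀
    module L₁ = Lattice L₁
  open ConvexSublattice

  projection : ConvexSublattice (L₀ ×L L₁) → ConvexSublattice L₀
  projection S = record
    { member   = λ a → ∃ λ b → (a , b) ∈ member S
    ; nonempty = let ((a , b) , ab∈S) = nonempty S in a , b , ab∈S
    ; convex   = λ { {x} {y} {z} (b , xb∈S) (d , zd∈S) x≤y y≤z →
        b L₁.∧ d , convex S (∧-closed S xb∈S zd∈S) (∨-closed S xb∈S zd∈S)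
          (L₀.trans (L₀.x∧y≤x x z) x≤y , L₁.refl)
          (L₀.trans y≤z (L₀.y≤x∨y x z) , L₁.trans (L₁.x∧y≤x b d) (L₁.x≤x∨y b d)) }
    ; ∧-closed = λ { {x} {y} (b , xb∈S) (d , yd∈S) → b L₁.∧ d , ∧-closed S xb∈S yd∈S }
    ; ∨-closed = λ { {x} {y} (b , xb∈S) (d , yd∈S) → b L₁.∨ d , ∨-closed S xb∈S yd∈S }
    }

  fibre : (S : ConvexSublattice (L₀ ×L L₁)) (a : L₀.Carrier) →
          a ∈ member (projection S) → ConvexSublattice L₁
  fibre S a (b , ab∈S) = record
    { member   = λ y → (a , y) ∈ member S
    ; nonempty = b , ab∈S
    ; convex   = λ ax∈S az∈S x≤y y≤z → convex S ax∈S az∈S (L₀.refl , x≤y) (L₀.refl , y≤z)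
    ; ∧-closed = λ {x} {y} ax∈S ay∈S → convex S (∧-closed S ax∈S ay∈S) ax∈S
        (L₀.x∧y≤x a a , L₁.refl) (L₀.refl , L₁.x∧y≤x x y)
    ; ∨-closed = λ {x} {y} ax∈S ay∈S → convex S ax∈S (∨-closed S ax∈S ay∈S)
        (L₀.refl , L₁.x≤x∨y x y) (L₀.x≤x∨y a a , L₁.refl)
    }

  projection-mono : ∀ {X Y} → X ≤bd Y → projection X ≤bd projection Y
  projection-mono (up , down) =
      (λ a (b , ab∈X) → let ((p , q) , pq∈Y , (a≤p , _)) = up (a , b) ab∈X in p , (q , pq∈Y) , a≤p)
    , (λ a (b , ab∈Y) → let ((p , q) , pq∈X , (p≤a , _)) = down (a , b) ab∈Y in p , (q , pq∈X) , p≤a)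

  fibre-mono : ∀ {X Y} → X ≤bd Y →
               ∀ a (a∈πX : a ∈ member (projection X)) a' (a'∈πY : a' ∈ member (projection Y)) →
               fibre X a a∈πX ≤bd fibre Y a' a'∈πY
  fibre-mono {X} {Y} (up , down) a (h , ah∈X) a' (g , a'g∈Y) = dominated , dominating
    where
    dominated : ∀ e → (a , e) ∈ member X → ∃ λ f → ((a' , f) ∈ member Y) × (e L₁.≤ f)
    dominated e ae∈X =
      let ((p , q) , pq∈Y , (_ , e≤q)) = up (a , e) ae∈X
      in g L₁.∨ q
       , convex Y a'g∈Y (∨-closed Y a'g∈Y pq∈Y)
           (L₀.refl , L₁.x≤x∨y g q) (L₀.x≤x∨y a' p , L₁.refl)
       , L₁.trans e≤q (L₁.y≤x∨y g q)

    dominating : ∀ f → (a' , f) ∈ member Y → ∃ λ e → ((a , e) ∈ member X) × (e L₁.≤ f)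
    dominating f a'f∈Y =
      let ((p , q) , pq∈X , (_ , q≤f)) = down (a' , f) a'f∈Y
      in h L₁.∧ q
       , convex X (∧-closed X ah∈X pq∈X) ah∈X
           (L₀.x∧y≤x a p , L₁.refl) (L₀.refl , L₁.x∧y≤x h q)
       , L₁.trans (L₁.x∧y≤y h q) q≤f

  CLSP-× : CLSP L₀ → CLSP L₁ → CLSP (L₀ ×L L₁)
  CLSP-× (φ₀ , φ₀∈ , φ₀-mono) (φ₁ , φ₁∈ , φ₁-mono) = φ , φ∈ , φ-mono
    where
    base : ConvexSublattice (L₀ ×L L₁) → L₀.Carrier
    base S = φ₀ (projection S)

    fibreAtBase : ConvexSublattice (L₀ ×L L₁) → ConvexSublattice L₁
    fibreAtBase S = fibre S (base S) (φ₀∈ (projection S))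

    φ : ConvexSublattice (L₀ ×L L₁) → Lattice.Carrier (L₀ ×L L₁)
    φ S = base S , φ₁ (fibreAtBase S)

    φ∈ : ∀ S → φ S ∈ member S
    φ∈ S = φ₁∈ (fibreAtBase S)

    φ-mono : ∀ X Y → X ≤bd Y → Lattice._≤_ (L₀ ×L L₁) (φ X) (φ Y)
    φ-mono X Y X≤Y =
        φ₀-mono (projection X) (projection Y) (projection-mono {X} {Y} X≤Y)
      , φ₁-mono (fibreAtBase X) (fibreAtBase Y)
          (fibre-mono {X} {Y} X≤Y (base X) (φ₀∈ (projection X)) (base Y) (φ₀∈ (projection Y)))

mainTheorem10 : {c ℓ₁ ℓ₂ : Level} (L₀ L₁ : Lattice c ℓ₁ ℓ₂) →
                CLSP L₀ → CLSP L₁ → CLSP (L₀ ×L L₁)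
mainTheorem10 = CLSP-×
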